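{- For every graph $G$, $\pi_{T_w}(G)\le \min\{\pi(G),\pi'(G)\}+1$.
   Context: All graphs are finite and simple. A sequence is repetitive if it contains a block of consecutive terms $r_1\dots r_{2n}$ ($n\ge1$) with $r_i=r_{n+i}$ for all $i$, and nonrepetitive otherwise. A vertex-colouring of $G$ is nonrepetitive if for every path $v_1v_2\dots v_k$ in $G$ the sequence of vertex colours is nonrepetitive; $\pi(G)$ (Thue chromatic number) is the minimum number of colours in such a colouring. Nonrepetitive edge-colourings (colour sequences of consecutive edges of every path are nonrepetitive) and the Thue chromatic index $\pi'(G)$ are defined analogously. A weak total Thue colouring of $G$ is a colouring of $V(G)\cup E(G)$ such that for every path $v_0e_1v_1e_2\dots e_kv_k$ in $G$ the sequence $\varphi(v_0)\varphi(e_1)\varphi(v_1)\dots\varphi(e_k)\varphi(v_k)$ is nonrepetitive; $\pi_{T_w}(G)$ is the minimum number of colours in a weak total Thue colouring of $G$. -}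

module Defs where

open import Data.Nat using (ℕ; _≤_)
open import Data.Fin using (Fin)
open import Data.Bool using (Bool; T; true; false)
open import Data.List using (List; []; _∷_; _++_; map)
open import Data.List.Relation.Unary.Unique.Propositional using (Unique)
open import Data.Product using (Σ; ∃; _×_; _,_)
open import Relation.Nullary using (¬_)
open import Relation.Binary.PropositionalEquality using (_≡_)

record Graph (n : ℕ) : Set where
  field
    adj    : Fin n → Fin n → Bool
    sym    : ∀ u v → adj u v ≡ adj v u
    irrefl : ∀ v → adj v v ≡ false
open Graph public

Repetitive : {A : Set} → List A → Set
Repetitive {A} l =
  Σ (List A) λ xs → Σ (List A) λ ys → Σ (List A) λ zs →
    (¬ ys ≡ []) × (l ≡ xs ++ (ys ++ ys) ++ zs)

Nonrepetitive : {A : Set} → List A → Set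
Nonrepetitive l = ¬ Repetitive l

data Walk {n : ℕ} (G : Graph n) : Fin n → Set where
  single : (v : Fin n) → Walk G v
  cons   : (u : Fin n) {v : Fin n} → T (adj G u v) → Walk G v → Walk G u

verts : ∀ {n} {G : Graph n} {u} → Walk G u → List (Fin n)
verts (single v)     = v ∷ []
verts (cons u _ w)   = u ∷ verts w

IsPath : ∀ {n} {G : Graph n} {u} → Walk G u → Set
IsPath w = Unique (verts w)

EdgeCol : ∀ {n} → Graph n → ℕ → Set
EdgeCol {n} G k = (u v : Fin n) → T (adj G u v) → Fin k

SymEdgeCol : ∀ {n} {G : Graph n} {k} → EdgeCol G k → Set
SymEdgeCol {n} {G} c = ∀ (u v : Fin n) (p : T (adj G u v)) (q : T (adj G v u)) → c u v p ≡ c v u q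

edgeSeq : ∀ {n} {G : Graph n} {k} {u} → EdgeCol G k → Walk G u → List (Fin k)
edgeSeq c (single v)          = []
edgeSeq c (cons u {v} p w)    = c u v p ∷ edgeSeq c w

totalSeq : ∀ {n} {G : Graph n} {k} {u} → (Fin n → Fin k) → EdgeCol G k → Walk G u → List (Fin k)
totalSeq cv ce (single v)       = cv v ∷ []
totalSeq cv ce (cons u {v} p w) = cv u ∷ ce u v p ∷ totalSeq cv ce w

HasNRVertexCol : ∀ {n} → Graph n → ℕ → Set
HasNRVertexCol {n} G k = Σ (Fin n → Fin k) λ c →
  ∀ (u : Fin n) (w : Walk G u) → IsPath w → Nonrepetitive (map c (verts w))

HasNREdgeCol : ∀ {n} → Graph n → ℕ → Set
HasNREdgeCol {n} G k = Σ (EdgeCol G k) λ c → SymEdgeCol {G = G} c ×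
  (∀ (u : Fin n) (w : Walk G u) → IsPath w → Nonrepetitive (edgeSeq c w))

HasWeakTotalThueCol : ∀ {n} → Graph n → ℕ → Set
HasWeakTotalThueCol {n} G k =
  Σ (Fin n → Fin k) λ cv → Σ (EdgeCol G k) λ ce → SymEdgeCol {G = G} ce ×
  (∀ (u : Fin n) (w : Walk G u) → IsPath w → Nonrepetitive (totalSeq cv ce w))

IsMinimum : (ℕ → Set) → ℕ → Set
IsMinimum P k = P k × (∀ j → P j → k ≤ j)

ThueNumber : ∀ {n} → Graph n → ℕ → Set
ThueNumber G = IsMinimum (HasNRVertexCol G)

ThueIndex : ∀ {n} → Graph n → ℕ → Set
ThueIndex G = IsMinimum (HasNREdgeCol G)

WeakTotalThueNumber : ∀ {n} → Graph n → ℕ → Set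
WeakTotalThueNumber G = IsMinimum (HasWeakTotalThueCol G)

-- Put one fresh colour e on every edge (resp. every vertex) and the colours of a
-- nonrepetitive vertex (resp. edge) colouring on the other elements. Along a path the
-- total colour sequence is then, after adding an e at each end in the vertex case,
-- e x₁ e x₂ … e xₙ e with all xᵢ ≠ e. A square r r in such a sequence has |r| even,
-- since otherwise the first letter of r would sit both at a position of e and at a
-- position of some xᵢ; hence keeping every other letter turns it into a square in
-- x₁ … xₙ.
module Submission where

open import Defs hiding (sym)
open import Data.Bool using (Bool; true; false; not; _xor_)
open import Data.Bool.Properties using (not-involutive; not-¬; not-distribˡ-xor; xor-comm; xor-identityʳ)
open import Data.Empty using (⊥-elim)
open import Data.Fin using (Fin; inject₁; fromℕ)
open import Data.Fin.Properties using (fromℕ≢inject₁; inject₁-injective)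
open import Data.List using (List; []; _∷_; _++_; map)
open import Data.List.Membership.Propositional using (_∈_)
open import Data.List.Membership.Propositional.Properties using (∈-++⁺ʳ)
open import Data.List.Properties using (++-assoc; ∷-injective; map-injective)
open import Data.List.Relation.Unary.All as All using (All)
open import Data.List.Relation.Unary.All.Properties using (map⁺)
open import Data.List.Relation.Unary.Any using (here)
open import Data.Nat using (ℕ; suc; _≤_; _+_; _⊓_)
open import Data.Nat.Properties using (+-comm; ⊓-glb)
open import Data.Product using (∃₂; _×_; _,_)
open import Function using (_∘_)
open import Function.Definitions using (Injective)
open import Relation.Binary.PropositionalEquality
  using (_≡_; _≢_; refl; sym; trans; cong; subst; module ≡-Reasoning)

module _ {A : Set} where

  parity : List A → Bool
  parity []      = false
  parity (_ ∷ u) = not (parity u)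

  parity-++ : ∀ u v → parity (u ++ v) ≡ parity u xor parity v
  parity-++ []      v = refl
  parity-++ (_ ∷ u) v = trans (cong not (parity-++ u v)) (not-distribˡ-xor (parity u) (parity v))

  alternate : Bool → List A → List A
  alternate _     []      = []
  alternate true  (x ∷ u) = x ∷ alternate false u
  alternate false (_ ∷ u) = alternate true u

  alternate-++ : ∀ k u v → alternate k (u ++ v) ≡ alternate k u ++ alternate (k xor parity u) v
  alternate-++ k     []      v = cong (λ k′ → alternate k′ v) (sym (xor-identityʳ k))
  alternate-++ true  (x ∷ u) v rewrite not-involutive (parity u) = cong (x ∷_) (alternate-++ false u v)
  alternate-++ false (_ ∷ u) v = alternate-++ true u v

  ∈-alternate : ∀ k u a v → k xor parity u ≡ true → a ∈ alternate k (u ++ a ∷ v)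
  ∈-alternate k u a v kept rewrite alternate-++ k u (a ∷ v) | kept = ∈-++⁺ʳ _ (here refl)

  alternate-≢[] : ∀ k {ys} → ys ≢ [] → parity ys ≡ false → alternate k ys ≢ []
  alternate-≢[] k     {[]}          ys≢[] _ = ⊥-elim (ys≢[] refl)
  alternate-≢[] k     {_ ∷ []}      _     ()
  alternate-≢[] true  {_ ∷ _ ∷ _}   _     _ ()
  alternate-≢[] false {_ ∷ _ ∷ _}   _     _ ()

module _ {A : Set} where

  Repetitive-infix : ∀ (u v w : List A) → Repetitive v → Repetitive (u ++ v ++ w)
  Repetitive-infix u v w (xs , ys , zs , ys≢[] , refl) = u ++ xs , ys , zs ++ w , ys≢[] , reassoc
    where
    open ≡-Reasoning
    reassoc : u ++ (xs ++ (ys ++ ys) ++ zs) ++ w ≡ (u ++ xs) ++ (ys ++ ys) ++ zs ++ w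
    reassoc = begin
      u ++ (xs ++ (ys ++ ys) ++ zs) ++ w  ≡⟨ cong (u ++_) (++-assoc xs _ w) ⟩
      u ++ xs ++ ((ys ++ ys) ++ zs) ++ w  ≡⟨ cong (λ t → u ++ xs ++ t) (++-assoc (ys ++ ys) zs w) ⟩
      u ++ xs ++ (ys ++ ys) ++ zs ++ w    ≡⟨ ++-assoc u xs _ ⟨
      (u ++ xs) ++ (ys ++ ys) ++ zs ++ w  ∎

  Repetitive-alternate : ∀ k (xs ys zs : List A) → ys ≢ [] → parity ys ≡ false →
                         Repetitive (alternate k (xs ++ (ys ++ ys) ++ zs))
  Repetitive-alternate k xs ys zs ys≢[] even =
    alternate k xs , alternate k′ ys , rest ,
    alternate-≢[] k′ ys≢[] even , split
    where
    open ≡-Reasoning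
    k′ = k xor parity xs
    rest = alternate (k′ xor parity (ys ++ ys)) zs
    split : alternate k (xs ++ (ys ++ ys) ++ zs) ≡ alternate k xs ++ (alternate k′ ys ++ alternate k′ ys) ++ rest
    split = begin
      alternate k (xs ++ (ys ++ ys) ++ zs)
        ≡⟨ alternate-++ k xs _ ⟩
      alternate k xs ++ alternate k′ ((ys ++ ys) ++ zs)
        ≡⟨ cong (alternate k xs ++_) (alternate-++ k′ (ys ++ ys) zs) ⟩
      alternate k xs ++ alternate k′ (ys ++ ys) ++ rest
        ≡⟨ cong (λ t → alternate k xs ++ t ++ rest) (alternate-++ k′ ys ys) ⟩
      alternate k xs ++ (alternate k′ ys ++ alternate (k′ xor parity ys) ys) ++ rest
        ≡⟨ cong (λ b → alternate k xs ++ (alternate k′ ys ++ alternate (k′ xor b) ys) ++ rest) even ⟩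
      alternate k xs ++ (alternate k′ ys ++ alternate (k′ xor false) ys) ++ rest
        ≡⟨ cong (λ k″ → alternate k xs ++ (alternate k′ ys ++ alternate k″ ys) ++ rest) (xor-identityʳ k′) ⟩
      alternate k xs ++ (alternate k′ ys ++ alternate k′ ys) ++ rest
        ∎

module _ {A B : Set} (f : A → B) where

  map-≡-++⁻ : ∀ l u v → map f l ≡ u ++ v →
              ∃₂ λ l₁ l₂ → l ≡ l₁ ++ l₂ × map f l₁ ≡ u × map f l₂ ≡ v
  map-≡-++⁻ l       []      v eq = [] , l , refl , refl , eq
  map-≡-++⁻ []      (_ ∷ _) v ()
  map-≡-++⁻ (x ∷ l) (_ ∷ u) v eq with ∷-injective eq
  ... | refl , eq′ with map-≡-++⁻ l u v eq′
  ...   | l₁ , l₂ , refl , refl , refl = x ∷ l₁ , l₂ , refl , refl , refl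

  Repetitive-map⁻ : Injective _≡_ _≡_ f → ∀ {l} → Repetitive (map f l) → Repetitive l
  Repetitive-map⁻ f-inj {l} (xs , ys , zs , ys≢[] , eq)
    with map-≡-++⁻ l xs _ eq
  ... | l₁ , r , refl , refl , eqr with map-≡-++⁻ r (ys ++ ys) zs eqr
  ... | s , l₃ , refl , eqs , refl with map-≡-++⁻ s ys ys eqs
  ... | m , m′ , refl , refl , eqm with map-injective f-inj eqm
  ... | refl = l₁ , m , l₃ , (λ { refl → ys≢[] refl }) , refl

module Framing {A : Set} (e : A) where

  framed : List A → List A
  framed []      = e ∷ []
  framed (x ∷ l) = e ∷ x ∷ framed l

  alternate-true-framed : ∀ l → All (_≡ e) (alternate true (framed l))
  alternate-true-framed []      = refl All.∷ All.[]
  alternate-true-framed (_ ∷ l) = refl All.∷ alternate-true-framed l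

  alternate-false-framed : ∀ l → alternate false (framed l) ≡ l
  alternate-false-framed []      = refl
  alternate-false-framed (x ∷ l) = cong (x ∷_) (alternate-false-framed l)

  framed-even-position : ∀ {l u a v} → framed l ≡ u ++ a ∷ v → parity u ≡ false → a ≡ e
  framed-even-position {l} {u} {a} {v} eq even =
    All.lookup (alternate-true-framed l)
      (subst (λ L → a ∈ alternate true L) (sym eq)
        (∈-alternate true u a v (cong not even)))

  framed-odd-position : ∀ {l u a v} → framed l ≡ u ++ a ∷ v → parity u ≡ true → a ∈ l
  framed-odd-position {l} {u} {a} {v} eq odd =
    subst (a ∈_) (alternate-false-framed l)
      (subst (λ L → a ∈ alternate false L) (sym eq) (∈-alternate false u a v odd))

  module _ {l : List A} (l≢e : All (_≢ e) l) where

    framed-position-parity : ∀ {u u′ a v v′} →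
      framed l ≡ u ++ a ∷ v → framed l ≡ u′ ++ a ∷ v′ → parity u ≡ parity u′
    framed-position-parity {u} {u′} eq eq′ with parity u in pu | parity u′ in pu′
    ... | false | false = refl
    ... | true  | true  = refl
    ... | false | true  = ⊥-elim (All.lookup l≢e (framed-odd-position eq′ pu′) (framed-even-position eq pu))
    ... | true  | false = ⊥-elim (All.lookup l≢e (framed-odd-position eq pu) (framed-even-position eq′ pu′))

    -- The two copies of the first letter of an odd-period square sit at positions of opposite parity.
    framed-no-odd-square : ∀ xs ys zs → parity ys ≡ true → framed l ≢ xs ++ (ys ++ ys) ++ zs
    framed-no-odd-square xs (a ∷ ys) zs odd eq =
      not-¬ refl (trans (framed-position-parity first second) shift)
      where
      open ≡-Reasoning
      first : framed l ≡ xs ++ a ∷ ys ++ a ∷ ys ++ zs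
      first = begin
        framed l                              ≡⟨ eq ⟩
        xs ++ ((a ∷ ys) ++ a ∷ ys) ++ zs      ≡⟨ cong (λ t → xs ++ a ∷ t) (++-assoc ys (a ∷ ys) zs) ⟩
        xs ++ a ∷ ys ++ a ∷ ys ++ zs          ∎
      second : framed l ≡ (xs ++ a ∷ ys) ++ a ∷ ys ++ zs
      second = begin
        framed l                              ≡⟨ first ⟩
        xs ++ a ∷ ys ++ a ∷ ys ++ zs          ≡⟨ ++-assoc xs (a ∷ ys) _ ⟨
        (xs ++ a ∷ ys) ++ a ∷ ys ++ zs        ∎
      shift : parity (xs ++ a ∷ ys) ≡ not (parity xs)
      shift = begin
        parity (xs ++ a ∷ ys)                 ≡⟨ parity-++ xs (a ∷ ys) ⟩
        parity xs xor parity (a ∷ ys)         ≡⟨ cong (parity xs xor_) odd ⟩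
        parity xs xor true                    ≡⟨ xor-comm (parity xs) true ⟩
        not (parity xs)                       ∎

    framed-reflects-repetition : Repetitive (framed l) → Repetitive l
    framed-reflects-repetition (xs , ys , zs , ys≢[] , eq) with parity ys in p
    ... | true  = ⊥-elim (framed-no-odd-square xs ys zs p eq)
    ... | false =
      subst Repetitive (alternate-false-framed l)
        (subst (Repetitive ∘ alternate false) (sym eq) (Repetitive-alternate false xs ys zs ys≢[] p))

module _ {n : ℕ} {G : Graph n} {k m : ℕ} (f : Fin k → Fin m) (e : Fin m) where
  open Framing e

  framed-vertex-colours : ∀ (c : Fin n → Fin k) {u} (w : Walk G u) →
    e ∷ totalSeq (f ∘ c) (λ _ _ _ → e) w ++ e ∷ [] ≡ framed (map f (map c (verts w)))
  framed-vertex-colours c (single v)   = refl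
  framed-vertex-colours c (cons u _ w) = cong (λ t → e ∷ f (c u) ∷ t) (framed-vertex-colours c w)

  framed-edge-colours : ∀ (c : EdgeCol G k) {u} (w : Walk G u) →
    totalSeq (λ _ → e) (λ u v q → f (c u v q)) w ≡ framed (map f (edgeSeq c w))
  framed-edge-colours c (single v)       = refl
  framed-edge-colours c (cons u {v} q w) = cong (λ t → e ∷ f (c u v q) ∷ t) (framed-edge-colours c w)

module _ {n : ℕ} {G : Graph n} {k : ℕ} where
  open Framing (fromℕ k)

  private
    reflects-through-inject₁ : ∀ {l : List (Fin k)} → Repetitive (framed (map inject₁ l)) → Repetitive l
    reflects-through-inject₁ {l} =
      Repetitive-map⁻ inject₁ inject₁-injective
      ∘ framed-reflects-repetition (map⁺ (All.universal (λ _ → fromℕ≢inject₁ ∘ sym) l))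

  HasNRVertexCol⇒HasWeakTotalThueCol : HasNRVertexCol G k → HasWeakTotalThueCol G (suc k)
  HasNRVertexCol⇒HasWeakTotalThueCol (c , nonrep) =
    inject₁ ∘ c , (λ _ _ _ → fromℕ k) , (λ _ _ _ _ → refl) ,
    λ u w path rep → nonrep u w path (reflects-through-inject₁
      (subst Repetitive (framed-vertex-colours inject₁ (fromℕ k) c w)
        (Repetitive-infix (fromℕ k ∷ []) _ (fromℕ k ∷ []) rep)))

  HasNREdgeCol⇒HasWeakTotalThueCol : HasNREdgeCol G k → HasWeakTotalThueCol G (suc k)
  HasNREdgeCol⇒HasWeakTotalThueCol (c , c-sym , nonrep) =
    (λ _ → fromℕ k) , (λ u v q → inject₁ (c u v q)) , (λ u v p q → cong inject₁ (c-sym u v p q)) ,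
    λ u w path rep → nonrep u w path (reflects-through-inject₁
      (subst Repetitive (framed-edge-colours inject₁ (fromℕ k) c w) rep))

mainTheorem2 : ∀ {n : ℕ} (G : Graph n) (p p' t : ℕ) →
    ThueNumber G p → ThueIndex G p' → WeakTotalThueNumber G t →
    t ≤ (p ⊓ p') + 1
mainTheorem2 G p p' t (vertexCol , _) (edgeCol , _) (_ , t-minimal) =
  subst (t ≤_) (+-comm 1 (p ⊓ p'))
    (⊓-glb (t-minimal (suc p)  (HasNRVertexCol⇒HasWeakTotalThueCol vertexCol))
           (t-minimal (suc p') (HasNREdgeCol⇒HasWeakTotalThueCol edgeCol)))
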